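{- Let $n$ be a positive integer, $0\le i<j<n$ integers, $\alpha,\beta\in\mathbb{F}_{2^n}$, and suppose $\Phi(x)=\alpha x^{2^i}+\beta x^{2^j}$ is a permutation of $\mathbb{F}_{2^n}$. If the compositional inverse $\Phi^{ -1}$ (as a map of $\mathbb{F}_{2^n}$) is given by a linearized binomial $\gamma' x^{2^k}+\delta' x^{2^\ell}$ with $\gamma',\delta'\in\mathbb{F}_{2^n}$ and $0\le k<\ell<n$, then $n=2m$ and $j=m+i$ for a positive integer $m$, and $$\Phi^{ -1}(x)=\gamma x^{2^{m-i}}+\delta x^{2^{2m-i}},\qquad \gamma=\left(\frac{\beta^{2^{m}}}{\alpha^{2^{m}+1}+\beta^{2^{m}+1}}\right)^{2^{m-i}},\quad \delta=\left(\frac{\alpha}{\alpha^{2^{m}+1}+\beta^{2^{m}+1}}\right)^{2^{m-i}}.$$ Moreover, if $n=2m$, $0\le i<m$, $j=m+i$, and $\alpha,\beta\in\mathbb{F}_{2^n}$ satisfy $\alpha^{2^m+1}\neq\beta^{2^m+1}$, then $\Phi(x)=\alpha x^{2^i}+\beta x^{2^j}$ is a permutation of $\mathbb{F}_{2^n}$ with $\Phi^{ -1}(x)=\gamma x^{2^{m-i}}+\delta x^{2^{2m-i}}$, where $\gamma,\delta$ are given by the formulas above. -}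

module Defs where

open import Data.Nat using (ℕ; zero; suc)
open import Data.Fin using (Fin)
open import Data.Product using (_×_)
open import Relation.Binary.PropositionalEquality using (_≡_)
open import Relation.Nullary using (¬_)
open import Algebra.Structures using (IsCommutativeRing)
open import Function.Definitions using (Bijective)
open import Function.Bundles using (_↔_)

-- A finite field with 2^n elements (i.e. a model of F_{2^n}; all such fields
-- are isomorphic, so quantifying over them is the same as speaking of F_{2^n}).
record FiniteField2^ (n : ℕ) : Set₁ where
  infixl 7 _*_
  infixl 6 _+_
  field
    F     : Set
    _+_   : F → F → F
    _*_   : F → F → F
    -_    : F → F
    0#    : F
    1#    : F
    _⁻¹   : F → F
    isCommutativeRing : IsCommutativeRing _≡_ _+_ _*_ -_ 0# 1#
    0≢1   : ¬ (0# ≡ 1#)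
    inverseʳ : ∀ x → ¬ (x ≡ 0#) → x * (x ⁻¹) ≡ 1#
    -- characteristic 2 (a consequence of the cardinality, recorded for convenience)
    char2 : 1# + 1# ≡ 0#
    card  : F ↔ Fin (2 Data.Nat.^ n)

  infixr 8 _^_
  _^_ : F → ℕ → F
  x ^ zero  = 1#
  x ^ suc k = x * (x ^ k)

  -- division (only used with nonzero denominators)
  infixl 7 _/_
  _/_ : F → F → F
  a / b = a * (b ⁻¹)

  linBinom : F → ℕ → F → ℕ → F → F
  linBinom a s b t x = a * x ^ (2 Data.Nat.^ s) + b * x ^ (2 Data.Nat.^ t)

  γ-coef : ℕ → ℕ → F → F → F
  γ-coef m i α β =
    (β ^ (2 Data.Nat.^ m) / (α ^ (2 Data.Nat.^ m Data.Nat.+ 1) + β ^ (2 Data.Nat.^ m Data.Nat.+ 1)))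
      ^ (2 Data.Nat.^ (m Data.Nat.∸ i))

  δ-coef : ℕ → ℕ → F → F → F
  δ-coef m i α β =
    (α / (α ^ (2 Data.Nat.^ m Data.Nat.+ 1) + β ^ (2 Data.Nat.^ m Data.Nat.+ 1)))
      ^ (2 Data.Nat.^ (m Data.Nat.∸ i))

  IsPermutation : (F → F) → Set
  IsPermutation f = Bijective _≡_ _≡_ f

  IsInverseOf : (F → F) → (F → F) → Set
  IsInverseOf g f = (∀ x → f (g x) ≡ x) × (∀ x → g (f x) ≡ x)

open FiniteField2^ public
  using (F; 0#; linBinom; IsPermutation; IsInverseOf; γ-coef; δ-coef)
  renaming (_^_ to pow)

module Submission where

-- Let σ = x ↦ x^(2^m). Composing two linearized binomials gives the four monomials x^(2^e),
-- e ∈ {k+i, ℓ+i, k+j, ℓ+j}, with exponents taken mod n because x^(2^n) = x. A polynomial of degree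
-- below 2^n that vanishes on the whole field is zero, so Φ ∘ Φ⁻¹ = id forces these monomials to
-- cancel in pairs and against x; the only way is k+i ≡ ℓ+j and ℓ+i ≡ k+j (mod n), i.e. n = 2m and
-- j = m+i. For n = 2m the maps y ↦ a y + b σ(y) compose like 2×2 matrices twisted by the involution
-- σ; the matrix of Φ has determinant α^(2^m+1) + β^(2^m+1), and γ, δ come from the entries of its
-- inverse. In the first part this determinant cannot vanish, because the coefficient pattern forced
-- by Φ ∘ Φ⁻¹ = id would then give σ(α) = 0 or β = 0.

open import Defs using (FiniteField2^)
open import Data.Nat as ℕ using (ℕ; zero; suc)
open import Data.Fin as Fin using (Fin)
import Data.Fin.Properties as Fin
import Data.Nat.Properties as ℕ
open import Data.Fin.Permutation using (Permutation; permutation)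
open import Data.Product using (_×_; _,_; proj₁; proj₂; ∃-syntax)
open import Data.Sum using (_⊎_; inj₁; inj₂)
open import Data.List using (List; []; _∷_; _++_; length; applyUpTo; tabulate)
import Data.List.Properties as List
open import Data.List.Relation.Unary.All using (All; []; _∷_)
import Data.List.Relation.Unary.All as All
import Data.List.Relation.Unary.All.Properties as All
open import Data.List.Relation.Unary.AllPairs using (AllPairs; []; _∷_)
import Data.List.Relation.Unary.Unique.Propositional.Properties as Unique
open import Function.Base using (_∘_)
open import Function.Bundles using (Inverse; mk↔ₛ′; Bijection)
open import Function.Properties.Inverse using (↔⇒⤖)
open import Relation.Binary.PropositionalEquality
open import Relation.Binary.Definitions using (DecidableEquality)
open import Data.Empty using (⊥)
open import Relation.Nullary using (¬_; Dec; yes; no; contradiction)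
open import Relation.Nullary.Decidable using (decidable-stable)
open import Algebra.Bundles using (CommutativeRing)
open import Algebra.Structures using (IsCommutativeRing)
import Algebra.Properties.CommutativeMonoid.Sum as MonoidSum
import Algebra.Solver.Ring.NaturalCoefficients.Default as RingSolver

-- Exponents modulo n

module Exponents where
  open import Data.Nat
  open import Data.Nat.Properties
  open import Data.Nat.Solver using (module +-*-Solver)
  open +-*-Solver using (solve; _:+_; _:*_; _:=_; con)
  open import Relation.Binary.Definitions using (tri<; tri≈; tri>)

  -- e mod n, but only for e < n + n
  reduce : ℕ → ℕ → ℕ
  reduce n e with e <? n
  ... | yes _ = e
  ... | no  _ = e ∸ n

  data Reduction (n e r : ℕ) : Set where
    unchanged : e ≡ r → Reduction n e r
    wrapped   : e ≡ n + r → Reduction n e r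

  reduction : ∀ n e → Reduction n e (reduce n e)
  reduction n e with e <? n
  ... | yes _   = unchanged refl
  ... | no  e≮n = wrapped (sym (m+[n∸m]≡n (≮⇒≥ e≮n)))

  reduce-< : ∀ {n e} → e < n + n → reduce n e < n
  reduce-< {n} {e} e<2n with e <? n
  ... | yes e<n = e<n
  ... | no  e≮n = subst (e ∸ n <_) (m+n∸n≡m n n) (∸-monoˡ-< e<2n (≮⇒≥ e≮n))

  reduce-≡ : ∀ n e e′ → reduce n e ≡ reduce n e′ → e ≡ e′ ⊎ e ≡ n + e′ ⊎ e′ ≡ n + e
  reduce-≡ n e e′ eq with reduction n e | reduction n e′
  ... | unchanged p | unchanged q = inj₁ (trans p (trans eq (sym q)))
  ... | wrapped p   | wrapped q   = inj₁ (trans p (trans (cong (n +_) eq) (sym q)))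
  ... | wrapped p   | unchanged q = inj₂ (inj₁ (trans p (cong (n +_) (trans eq (sym q)))))
  ... | unchanged p | wrapped q   = inj₂ (inj₂ (trans q (cong (n +_) (trans (sym eq) (sym p)))))

  reduce-≡⇒≡ : ∀ {n e e′} → e < n + e′ → e′ < n + e → reduce n e ≡ reduce n e′ → e ≡ e′
  reduce-≡⇒≡ {n} {e} {e′} e<n+e′ e′<n+e eq with reduce-≡ n e e′ eq
  ... | inj₁ e≡e′          = e≡e′
  ... | inj₂ (inj₁ e≡n+e′) = contradiction e≡n+e′ (<⇒≢ e<n+e′)
  ... | inj₂ (inj₂ e′≡n+e) = contradiction e′≡n+e (<⇒≢ e′<n+e)

  reduce-≡⇒wrapped : ∀ {n e e′} → e < e′ → reduce n e ≡ reduce n e′ → e′ ≡ n + e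
  reduce-≡⇒wrapped {n} {e} {e′} e<e′ eq with reduce-≡ n e e′ eq
  ... | inj₁ e≡e′          = contradiction e≡e′ (<⇒≢ e<e′)
  ... | inj₂ (inj₁ e≡n+e′) = contradiction e≡n+e′ (<⇒≢ (<-≤-trans e<e′ (m≤n+m e′ n)))
  ... | inj₂ (inj₂ e′≡n+e) = e′≡n+e

  private
    +-<-n+ : ∀ {n u} w v → u < n → w + u < n + (w + v)
    +-<-n+ {n} {u} w v u<n = begin-strict
      w + u       <⟨ +-monoʳ-< w u<n ⟩
      w + n       ≡⟨ +-comm w n ⟩
      n + w       ≤⟨ +-monoʳ-≤ n (m≤m+n w v) ⟩
      n + (w + v) ∎
      where open ≤-Reasoning

  reduce-cancelˡ : ∀ {n u v} w → u < n → v < n → reduce n (w + u) ≡ reduce n (w + v) → u ≡ v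
  reduce-cancelˡ {n} {u} {v} w u<n v<n eq =
    +-cancelˡ-≡ w u v (reduce-≡⇒≡ {n} (+-<-n+ w v u<n) (+-<-n+ w u v<n) eq)

  reduce-cancelʳ : ∀ {n u v} w → u < n → v < n → reduce n (u + w) ≡ reduce n (v + w) → u ≡ v
  reduce-cancelʳ {n} {u} {v} w u<n v<n eq = reduce-cancelˡ w u<n v<n
    (subst₂ (λ a b → reduce n a ≡ reduce n b) (+-comm u w) (+-comm v w) eq)

  half-shift : ∀ {n i j k ℓ} → i < j → j < n → k < ℓ → ℓ < n →
    reduce n (k + i) ≡ reduce n (ℓ + j) → reduce n (ℓ + i) ≡ reduce n (k + j) →
    ∃[ m ] (1 ≤ m × n ≡ 2 * m × j ≡ m + i)
  half-shift {n} {i} {j} {k} {ℓ} i<j j<n k<ℓ ℓ<n eq₁ eq₂ = m , m<n⇒0<n∸m i<j , n≡2m , j≡m+i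
    where
    m : ℕ
    m = j ∸ i
    j≡m+i : j ≡ m + i
    j≡m+i = sym (m∸n+n≡m (<⇒≤ i<j))
    ℓ+j≡n+k+i : ℓ + j ≡ n + (k + i)
    ℓ+j≡n+k+i = reduce-≡⇒wrapped {n} (+-mono-< k<ℓ i<j) eq₁
    ℓ+i≡k+j : ℓ + i ≡ k + j
    ℓ+i≡k+j = reduce-≡⇒≡ {n}
      (<-≤-trans (+-mono-< ℓ<n i<j) (+-monoʳ-≤ n (m≤n+m j k)))
      (<-≤-trans (+-mono-< k<ℓ j<n) (≤-trans (≤-reflexive (+-comm ℓ n)) (+-monoʳ-≤ n (m≤m+n ℓ i))))
      eq₂
    ℓ≡k+m : ℓ ≡ k + m
    ℓ≡k+m = +-cancelʳ-≡ i ℓ (k + m)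
      (trans ℓ+i≡k+j (trans (cong (k +_) j≡m+i) (sym (+-assoc k m i))))
    n≡2m : n ≡ 2 * m
    n≡2m = sym (+-cancelʳ-≡ (k + i) (2 * m) n (begin
      2 * m + (k + i)         ≡⟨ solve 3 (λ k m i → con 2 :* m :+ (k :+ i) := (k :+ m) :+ (m :+ i)) refl k m i ⟩
      (k + m) + (m + i)       ≡⟨ cong₂ _+_ (sym ℓ≡k+m) (sym j≡m+i) ⟩
      ℓ + j                   ≡⟨ ℓ+j≡n+k+i ⟩
      n + (k + i)             ∎))
      where open ≡-Reasoning

  2^-injective : ∀ {a b} → 2 ^ a ≡ 2 ^ b → a ≡ b
  2^-injective {a} {b} eq with <-cmp a b
  ... | tri< a<b _ _ = contradiction eq (<⇒≢ (^-monoʳ-< 2 (s≤s (s≤s z≤n)) a<b))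
  ... | tri≈ _ a≡b _ = a≡b
  ... | tri> _ _ b<a = contradiction (sym eq) (<⇒≢ (^-monoʳ-< 2 (s≤s (s≤s z≤n)) b<a))

open Exponents

-- Fields of characteristic 2 and the Frobenius x ↦ x^(2^r)

module _ {n : ℕ} (K : FiniteField2^ n) where

  open FiniteField2^ K
  open IsCommutativeRing isCommutativeRing
    using (+-assoc; +-comm; +-identityˡ; +-identityʳ; *-assoc; *-comm; *-identityˡ; *-identityʳ;
           distribˡ; distribʳ; zeroˡ; zeroʳ)
  open ≡-Reasoning

  private
    ring : CommutativeRing _ _
    ring = record { isCommutativeRing = isCommutativeRing }

  open RingSolver (CommutativeRing.commutativeSemiring ring) using (solve; _:+_; _:*_; _:=_; con)

  x+x≡0 : ∀ x → x + x ≡ 0#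
  x+x≡0 x = begin
    x + x             ≡⟨ cong₂ _+_ (*-identityʳ x) (*-identityʳ x) ⟨
    x * 1# + x * 1#   ≡⟨ distribˡ x 1# 1# ⟨
    x * (1# + 1#)     ≡⟨ cong (x *_) char2 ⟩
    x * 0#            ≡⟨ zeroʳ x ⟩
    0#                ∎

  +≡0⇒≡ : ∀ {a b} → a + b ≡ 0# → a ≡ b
  +≡0⇒≡ {a} {b} a+b≡0 = begin
    a             ≡⟨ +-identityʳ a ⟨
    a + 0#        ≡⟨ cong (a +_) (x+x≡0 b) ⟨
    a + (b + b)   ≡⟨ +-assoc a b b ⟨
    (a + b) + b   ≡⟨ cong (_+ b) a+b≡0 ⟩
    0# + b        ≡⟨ +-identityˡ b ⟩
    b             ∎

  ≡⇒+≡0 : ∀ {a b} → a ≡ b → a + b ≡ 0#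
  ≡⇒+≡0 {a} refl = x+x≡0 a

  inverseˡ : ∀ x → ¬ x ≡ 0# → x ⁻¹ * x ≡ 1#
  inverseˡ x x≢0 = trans (*-comm (x ⁻¹) x) (inverseʳ x x≢0)

  *-cancelˡ-≡0 : ∀ {x y} → ¬ x ≡ 0# → x * y ≡ 0# → y ≡ 0#
  *-cancelˡ-≡0 {x} {y} x≢0 xy≡0 = begin
    y                ≡⟨ *-identityˡ y ⟨
    1# * y           ≡⟨ cong (_* y) (inverseˡ x x≢0) ⟨
    (x ⁻¹ * x) * y   ≡⟨ *-assoc (x ⁻¹) x y ⟩
    x ⁻¹ * (x * y)   ≡⟨ cong (x ⁻¹ *_) xy≡0 ⟩
    x ⁻¹ * 0#        ≡⟨ zeroʳ (x ⁻¹) ⟩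
    0#               ∎

  *-nonzero : ∀ {x y} → ¬ x ≡ 0# → ¬ y ≡ 0# → ¬ x * y ≡ 0#
  *-nonzero x≢0 y≢0 xy≡0 = y≢0 (*-cancelˡ-≡0 x≢0 xy≡0)

  *-cancelˡ : ∀ {x y z} → ¬ x ≡ 0# → x * y ≡ x * z → y ≡ z
  *-cancelˡ {x} {y} {z} x≢0 xy≡xz =
    +≡0⇒≡ (*-cancelˡ-≡0 x≢0 (trans (distribˡ x y z) (≡⇒+≡0 xy≡xz)))

  ⁻¹-unique : ∀ {y z} → y * z ≡ 1# → z ≡ y ⁻¹
  ⁻¹-unique {y} {z} yz≡1 = begin
    z                ≡⟨ *-identityˡ z ⟨
    1# * z           ≡⟨ cong (_* z) (inverseˡ y y≢0) ⟨
    (y ⁻¹ * y) * z   ≡⟨ *-assoc (y ⁻¹) y z ⟩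
    y ⁻¹ * (y * z)   ≡⟨ cong (y ⁻¹ *_) yz≡1 ⟩
    y ⁻¹ * 1#        ≡⟨ *-identityʳ (y ⁻¹) ⟩
    y ⁻¹             ∎
    where
    y≢0 : ¬ y ≡ 0#
    y≢0 refl = 0≢1 (trans (sym (zeroˡ z)) yz≡1)

  ^-+ : ∀ x a b → x ^ (a ℕ.+ b) ≡ x ^ a * x ^ b
  ^-+ x zero    b = sym (*-identityˡ (x ^ b))
  ^-+ x (suc a) b = trans (cong (x *_) (^-+ x a b)) (sym (*-assoc x (x ^ a) (x ^ b)))

  *-^ : ∀ x y k → (x * y) ^ k ≡ x ^ k * y ^ k
  *-^ x y zero    = sym (*-identityˡ 1#)
  *-^ x y (suc k) = trans (cong ((x * y) *_) (*-^ x y k))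
    (solve 4 (λ x y a b → (x :* y) :* (a :* b) := (x :* a) :* (y :* b)) refl x y (x ^ k) (y ^ k))

  1^ : ∀ k → 1# ^ k ≡ 1#
  1^ zero    = refl
  1^ (suc k) = trans (*-identityˡ (1# ^ k)) (1^ k)

  ^-* : ∀ x a b → x ^ (a ℕ.* b) ≡ (x ^ a) ^ b
  ^-* x zero    b = sym (1^ b)
  ^-* x (suc a) b = begin
    x ^ (b ℕ.+ a ℕ.* b)      ≡⟨ ^-+ x b (a ℕ.* b) ⟩
    x ^ b * x ^ (a ℕ.* b)    ≡⟨ cong (x ^ b *_) (^-* x a b) ⟩
    x ^ b * (x ^ a) ^ b      ≡⟨ *-^ x (x ^ a) b ⟨
    (x * x ^ a) ^ b          ∎

  ^-nonzero : ∀ {x} k → ¬ x ≡ 0# → ¬ x ^ k ≡ 0#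
  ^-nonzero zero    x≢0 1≡0 = 0≢1 (sym 1≡0)
  ^-nonzero (suc k) x≢0 = *-nonzero x≢0 (^-nonzero k x≢0)

  frob : ℕ → F → F
  frob r x = x ^ (2 ℕ.^ r)

  square-+ : ∀ a b → (a + b) ^ 2 ≡ a ^ 2 + b ^ 2
  square-+ a b = begin
    (a + b) ^ 2                          ≡⟨ solve 2 (λ a b → (a :+ b) :* ((a :+ b) :* con 1)
                                              := (a :* (a :* con 1) :+ b :* (b :* con 1)) :+ (a :* b :+ a :* b)) refl a b ⟩
    (a ^ 2 + b ^ 2) + (a * b + a * b)    ≡⟨ cong (a ^ 2 + b ^ 2 +_) (x+x≡0 (a * b)) ⟩
    (a ^ 2 + b ^ 2) + 0#                 ≡⟨ +-identityʳ _ ⟩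
    a ^ 2 + b ^ 2                        ∎

  frob-+ : ∀ r a b → frob r (a + b) ≡ frob r a + frob r b
  frob-+ zero    a b = distribʳ 1# a b
  frob-+ (suc r) a b = begin
    frob (suc r) (a + b)            ≡⟨ ^-* (a + b) 2 (2 ℕ.^ r) ⟩
    frob r ((a + b) ^ 2)            ≡⟨ cong (frob r) (square-+ a b) ⟩
    frob r (a ^ 2 + b ^ 2)          ≡⟨ frob-+ r (a ^ 2) (b ^ 2) ⟩
    frob r (a ^ 2) + frob r (b ^ 2) ≡⟨ cong₂ _+_ (^-* a 2 (2 ℕ.^ r)) (^-* b 2 (2 ℕ.^ r)) ⟨
    frob (suc r) a + frob (suc r) b ∎

  frob-* : ∀ r a b → frob r (a * b) ≡ frob r a * frob r b
  frob-* r a b = *-^ a b (2 ℕ.^ r)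

  frob-linear : ∀ r a y b z → frob r (a * y + b * z) ≡ frob r a * frob r y + frob r b * frob r z
  frob-linear r a y b z = trans (frob-+ r (a * y) (b * z)) (cong₂ _+_ (frob-* r a y) (frob-* r b z))

  frob-∘ : ∀ a b x → frob (a ℕ.+ b) x ≡ frob b (frob a x)
  frob-∘ a b x = trans (cong (x ^_) (ℕ.^-distribˡ-+-* 2 a b)) (^-* x (2 ℕ.^ a) (2 ℕ.^ b))

  frob-0# : ∀ r → frob r 0# ≡ 0#
  frob-0# r = begin
    frob r 0#                 ≡⟨ cong (frob r) (+-identityʳ 0#) ⟨
    frob r (0# + 0#)          ≡⟨ frob-+ r 0# 0# ⟩
    frob r 0# + frob r 0#     ≡⟨ x+x≡0 (frob r 0#) ⟩
    0#                        ∎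

  frob-1# : ∀ r → frob r 1# ≡ 1#
  frob-1# r = 1^ (2 ℕ.^ r)

  frob-nonzero : ∀ {x} r → ¬ x ≡ 0# → ¬ frob r x ≡ 0#
  frob-nonzero r = ^-nonzero (2 ℕ.^ r)

  frob-⁻¹ : ∀ {x} r → ¬ x ≡ 0# → frob r (x ⁻¹) ≡ frob r x ⁻¹
  frob-⁻¹ {x} r x≢0 = ⁻¹-unique (begin
    frob r x * frob r (x ⁻¹)   ≡⟨ frob-* r x (x ⁻¹) ⟨
    frob r (x * x ⁻¹)          ≡⟨ cong (frob r) (inverseʳ x x≢0) ⟩
    frob r 1#                  ≡⟨ frob-1# r ⟩
    1#                         ∎)

  private
    N : ℕ
    N = 2 ℕ.^ n

    element : Fin N → F
    element = Inverse.from card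

    index : F → Fin N
    index = Inverse.to card

    index-element : ∀ t → index (element t) ≡ t
    index-element = Inverse.strictlyInverseˡ card

    element-index : ∀ x → element (index x) ≡ x
    element-index = Inverse.strictlyInverseʳ card

    open MonoidSum (CommutativeRing.*-commutativeMonoid ring)
      using (sum-permute; ∑-distrib-+; sum-cong-≗) renaming (sum to product)

  infix 4 _≟_
  _≟_ : DecidableEquality F
  a ≟ b with index a Fin.≟ index b
  ... | yes eq = yes (trans (sym (element-index a)) (trans (cong element eq) (element-index b)))
  ... | no  ne = no (λ a≡b → ne (cong index a≡b))

  product-nonzero : ∀ {M} (f : Fin M → F) → (∀ t → ¬ f t ≡ 0#) → ¬ product f ≡ 0#
  product-nonzero {zero}  f f≢0 1≡0 = 0≢1 (sym 1≡0)
  product-nonzero {suc M} f f≢0 = *-nonzero (f≢0 Fin.zero) (product-nonzero (f ∘ Fin.suc) (f≢0 ∘ Fin.suc))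

  product-const-except : ∀ {M} (f : Fin M → F) x t₀ → f t₀ ≡ 1# →
    (∀ t → ¬ t ≡ t₀ → f t ≡ x) → x * product f ≡ x ^ M
  product-const-except {suc M} f x Fin.zero f₀≡1 f≡x = cong (x *_) (begin
    f Fin.zero * product (f ∘ Fin.suc)   ≡⟨ cong (_* product (f ∘ Fin.suc)) f₀≡1 ⟩
    1# * product (f ∘ Fin.suc)           ≡⟨ *-identityˡ _ ⟩
    product (f ∘ Fin.suc)                ≡⟨ sum-cong-≗ {M} (λ t → f≡x (Fin.suc t) (λ ())) ⟩
    product {M} (λ _ → x)                ≡⟨ const-product M ⟩
    x ^ M                                ∎)
    where
    const-product : ∀ M → product {M} (λ _ → x) ≡ x ^ M
    const-product zero    = refl
    const-product (suc M) = cong (x *_) (const-product M)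
  product-const-except {suc M} f x (Fin.suc t₀) f₀≡1 f≡x = begin
    x * (f Fin.zero * product (f ∘ Fin.suc))   ≡⟨ cong (λ y → x * (y * _)) (f≡x Fin.zero (λ ())) ⟩
    x * (x * product (f ∘ Fin.suc))            ≡⟨ cong (x *_) (product-const-except (f ∘ Fin.suc) x t₀ f₀≡1
                                                    (λ t t≢t₀ → f≡x (Fin.suc t) (t≢t₀ ∘ Fin.suc-injective))) ⟩
    x * x ^ M                                  ∎

  orOne : F → F
  orOne y with y ≟ 0#
  ... | yes _ = 1#
  ... | no  _ = y

  orOne-nonzero : ∀ y → ¬ orOne y ≡ 0#
  orOne-nonzero y with y ≟ 0#
  ... | yes _   = λ 1≡0 → 0≢1 (sym 1≡0)
  ... | no  y≢0 = y≢0

  -- Multiplying by x ≠ 0 permutes the field. The product of orOne over the field is therefore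
  -- unchanged, while each of its N - 1 nonzero factors picks up a factor x: hence x^(N-1) = 1.
  private
    module Fermat {x : F} (x≢0 : ¬ x ≡ 0#) where
      x*[x⁻¹*y]≡y : ∀ y → x * (x ⁻¹ * y) ≡ y
      x*[x⁻¹*y]≡y y = trans (sym (*-assoc x (x ⁻¹) y))
        (trans (cong (_* y) (inverseʳ x x≢0)) (*-identityˡ y))

      x⁻¹*[x*y]≡y : ∀ y → x ⁻¹ * (x * y) ≡ y
      x⁻¹*[x*y]≡y y = trans (sym (*-assoc (x ⁻¹) x y))
        (trans (cong (_* y) (inverseˡ x x≢0)) (*-identityˡ y))

      scaling : Permutation N N
      scaling = permutation (λ t → index (x * element t)) (λ t → index (x ⁻¹ * element t))
        (λ t → trans (cong (λ y → index (x * y)) (element-index _))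
          (trans (cong index (x*[x⁻¹*y]≡y (element t))) (index-element t)))
        (λ t → trans (cong (λ y → index (x ⁻¹ * y)) (element-index _))
          (trans (cong index (x⁻¹*[x*y]≡y (element t))) (index-element t)))

      weight : F → F
      weight y with y ≟ 0#
      ... | yes _ = 1#
      ... | no  _ = x

      orOne-* : ∀ y → orOne (x * y) ≡ weight y * orOne y
      orOne-* y with y ≟ 0# | x * y ≟ 0#
      ... | yes _    | yes _    = sym (*-identityˡ 1#)
      ... | yes refl | no xy≢0  = contradiction (zeroʳ x) xy≢0
      ... | no  y≢0  | yes xy≡0 = contradiction xy≡0 (*-nonzero x≢0 y≢0)
      ... | no  _    | no  _    = refl

      P W : F
      P = product (orOne ∘ element)
      W = product (weight ∘ element)

      P≡W*P : P ≡ W * P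
      P≡W*P = begin
        P                                          ≡⟨ sum-permute (orOne ∘ element) scaling ⟩
        product (λ t → orOne (element (index (x * element t))))
                                                   ≡⟨ sum-cong-≗ (λ t → trans (cong orOne (element-index _)) (orOne-* (element t))) ⟩
        product (λ t → weight (element t) * orOne (element t))
                                                   ≡⟨ ∑-distrib-+ (weight ∘ element) (orOne ∘ element) ⟩
        W * P                                      ∎

      W≡1 : W ≡ 1#
      W≡1 = *-cancelˡ (product-nonzero (orOne ∘ element) (orOne-nonzero ∘ element))
        (trans (*-comm P W) (trans (sym P≡W*P) (sym (*-identityʳ P))))

      weight-at-0 : weight (element (index 0#)) ≡ 1#
      weight-at-0 rewrite element-index 0# with 0# ≟ 0#
      ... | yes _  = refl
      ... | no 0≢0 = contradiction refl 0≢0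

      weight-elsewhere : ∀ t → ¬ t ≡ index 0# → weight (element t) ≡ x
      weight-elsewhere t t≢0 with element t ≟ 0#
      ... | yes t≡0 = contradiction (trans (sym (index-element t)) (cong index t≡0)) t≢0
      ... | no  _   = refl

      fermat : x ^ N ≡ x
      fermat = begin
        x ^ N      ≡⟨ product-const-except (weight ∘ element) x (index 0#) weight-at-0 weight-elsewhere ⟨
        x * W      ≡⟨ cong (x *_) W≡1 ⟩
        x * 1#     ≡⟨ *-identityʳ x ⟩
        x          ∎

  frob-period : ∀ x → frob n x ≡ x
  frob-period x with x ≟ 0#
  ... | yes refl = frob-0# n
  ... | no  x≢0  = Fermat.fermat x≢0

  frob-n+ : ∀ r x → frob (n ℕ.+ r) x ≡ frob r x
  frob-n+ r x = trans (frob-∘ n r x) (cong (frob r) (frob-period x))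

  frob-reduce : ∀ e x → frob e x ≡ frob (reduce n e) x
  frob-reduce e x with reduction n e
  ... | unchanged e≡r = cong (λ r → frob r x) e≡r
  ... | wrapped e≡n+r = trans (cong (λ r → frob r x) e≡n+r) (frob-n+ _ x)

  -- Polynomials vanishing on the whole field

  eval : List F → F → F
  eval []      x = 0#
  eval (c ∷ p) x = c + x * eval p x

  divide : List F → F → List F
  divide []          a = []
  divide (c ∷ [])    a = []
  divide (c ∷ d ∷ p) a = eval (d ∷ p) a ∷ divide (d ∷ p) a

  eval-divide : ∀ p a x → eval p x ≡ eval p a + (x + a) * eval (divide p a) x
  eval-divide []          a x = sym (trans (+-identityˡ _) (zeroʳ (x + a)))
  eval-divide (c ∷ [])    a x = solve 3 (λ c x a → c :+ x :* con 0 := (c :+ a :* con 0) :+ (x :+ a) :* con 0) refl c x a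
  eval-divide (c ∷ d ∷ p) a x = begin
    c + x * q                              ≡⟨ cong (λ y → c + x * y) (eval-divide (d ∷ p) a x) ⟩
    c + x * (qa + (x + a) * r)             ≡⟨ +-identityʳ _ ⟨
    c + x * (qa + (x + a) * r) + 0#        ≡⟨ cong (c + x * (qa + (x + a) * r) +_) (x+x≡0 (a * qa)) ⟨
    c + x * (qa + (x + a) * r) + (a * qa + a * qa)
      ≡⟨ solve 5 (λ c x a qa r → c :+ x :* (qa :+ (x :+ a) :* r) :+ (a :* qa :+ a :* qa)
                                  := (c :+ a :* qa) :+ (x :+ a) :* (qa :+ x :* r)) refl c x a qa r ⟩
    (c + a * qa) + (x + a) * (qa + x * r)  ∎
    where
    q qa r : F
    q  = eval (d ∷ p) x
    qa = eval (d ∷ p) a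
    r  = eval (divide (d ∷ p) a) x

  length-divide : ∀ c p a → length (divide (c ∷ p) a) ≡ length p
  length-divide c []      a = refl
  length-divide c (d ∷ p) a = cong suc (length-divide d p a)

  IsZero : List F → Set
  IsZero = All (_≡ 0#)

  divide-zero : ∀ p a → IsZero (divide p a) → eval p a ≡ 0# → IsZero p
  divide-zero []          a []            pa≡0 = []
  divide-zero (c ∷ [])    a []            pa≡0 = trans (sym (trans (cong (c +_) (zeroʳ a)) (+-identityʳ c))) pa≡0 ∷ []
  divide-zero (c ∷ d ∷ p) a (qa≡0 ∷ rest) pa≡0 = c≡0 ∷ divide-zero (d ∷ p) a rest qa≡0
    where
    c≡0 : c ≡ 0#
    c≡0 = begin
      c                      ≡⟨ +-identityʳ c ⟨
      c + 0#                 ≡⟨ cong (c +_) (zeroʳ a) ⟨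
      c + a * 0#             ≡⟨ cong (λ y → c + a * y) qa≡0 ⟨
      c + a * eval (d ∷ p) a ≡⟨ pa≡0 ⟩
      0#                     ∎

  root-divide : ∀ p {a b} → ¬ b ≡ a → eval p a ≡ 0# → eval p b ≡ 0# → eval (divide p a) b ≡ 0#
  root-divide p {a} {b} b≢a pa≡0 pb≡0 = *-cancelˡ-≡0 (b≢a ∘ +≡0⇒≡) (begin
    (b + a) * eval (divide p a) b         ≡⟨ +-identityˡ _ ⟨
    0# + (b + a) * eval (divide p a) b    ≡⟨ cong (_+ (b + a) * eval (divide p a) b) pa≡0 ⟨
    eval p a + (b + a) * eval (divide p a) b
                                          ≡⟨ eval-divide p a b ⟨
    eval p b                              ≡⟨ pb≡0 ⟩
    0#                                    ∎)

  roots⇒zero : ∀ p (as : List F) → length p ℕ.≤ length as → AllPairs (λ a b → ¬ a ≡ b) as →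
    All (λ a → eval p a ≡ 0#) as → IsZero p
  roots⇒zero []      as       _           _                _                = []
  roots⇒zero (c ∷ p) (a ∷ as) (ℕ.s≤s len) (a≢as ∷ distinct) (pa≡0 ∷ pas≡0) =
    divide-zero (c ∷ p) a
      (roots⇒zero (divide (c ∷ p) a) as (ℕ.≤-trans (ℕ.≤-reflexive (length-divide c p a)) len) distinct
        (All.zipWith (λ { (a≢b , pb≡0) → root-divide (c ∷ p) (a≢b ∘ sym) pa≡0 pb≡0 }) (a≢as , pas≡0)))
      pa≡0

  vanishing⇒zero : ∀ p → length p ℕ.≤ N → (∀ x → eval p x ≡ 0#) → IsZero p
  vanishing⇒zero p len p≡0 = roots⇒zero p (tabulate element)
    (ℕ.≤-trans len (ℕ.≤-reflexive (sym (List.length-tabulate element))))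
    (Unique.tabulate⁺ (λ {s} {t} eq → trans (sym (index-element s)) (trans (cong index eq) (index-element t))))
    (All.tabulate⁺ (λ t → p≡0 (element t)))

  evalTerms : List (ℕ × F) → F → F
  evalTerms []             x = 0#
  evalTerms ((e , c) ∷ ts) x = c * x ^ e + evalTerms ts x

  monomialCoeff : ℕ → F → ℕ → F
  monomialCoeff zero    c zero    = c
  monomialCoeff zero    c (suc r) = 0#
  monomialCoeff (suc e) c zero    = 0#
  monomialCoeff (suc e) c (suc r) = monomialCoeff e c r

  monomialCoeff-≡ : ∀ {e r} c → e ≡ r → monomialCoeff e c r ≡ c
  monomialCoeff-≡ {zero}  c refl = refl
  monomialCoeff-≡ {suc e} c refl = monomialCoeff-≡ {e} c refl

  monomialCoeff-≢ : ∀ {e r} c → ¬ e ≡ r → monomialCoeff e c r ≡ 0#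
  monomialCoeff-≢ {zero}  {zero}  c 0≢0 = contradiction refl 0≢0
  monomialCoeff-≢ {zero}  {suc r} c _   = refl
  monomialCoeff-≢ {suc e} {zero}  c _   = refl
  monomialCoeff-≢ {suc e} {suc r} c e≢r = monomialCoeff-≢ c (e≢r ∘ cong suc)

  coeff : ℕ → List (ℕ × F) → F
  coeff r []             = 0#
  coeff r ((e , c) ∷ ts) = monomialCoeff e c r + coeff r ts

  coeff-absent : ∀ {r} ts → All (λ t → ¬ proj₁ t ≡ r) ts → coeff r ts ≡ 0#
  coeff-absent []             []             = refl
  coeff-absent ((e , c) ∷ ts) (e≢r ∷ absent) =
    trans (cong₂ _+_ (monomialCoeff-≢ c e≢r) (coeff-absent ts absent)) (+-identityˡ 0#)

  eval-zeros : ∀ D x → eval (applyUpTo (λ _ → 0#) D) x ≡ 0#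
  eval-zeros zero    x = refl
  eval-zeros (suc D) x = trans (cong (λ y → 0# + x * y) (eval-zeros D x)) (trans (+-identityˡ _) (zeroʳ x))

  eval-+ : ∀ D f g x → eval (applyUpTo (λ r → f r + g r) D) x ≡ eval (applyUpTo f D) x + eval (applyUpTo g D) x
  eval-+ zero    f g x = sym (+-identityˡ 0#)
  eval-+ (suc D) f g x = trans (cong (λ y → f 0 + g 0 + x * y) (eval-+ D (f ∘ suc) (g ∘ suc) x))
    (solve 5 (λ a b x u v → a :+ b :+ x :* (u :+ v) := (a :+ x :* u) :+ (b :+ x :* v)) refl (f 0) (g 0) x _ _)

  eval-monomial : ∀ {D e} c x → e ℕ.< D → eval (applyUpTo (monomialCoeff e c) D) x ≡ c * x ^ e
  eval-monomial {suc D} {zero}  c x _ = trans (cong (λ y → c + x * y) (eval-zeros D x))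
    (solve 2 (λ c x → c :+ x :* con 0 := c :* con 1) refl c x)
  eval-monomial {suc D} {suc e} c x (ℕ.s≤s e<D) = trans (cong (λ y → 0# + x * y) (eval-monomial c x e<D))
    (solve 3 (λ c x y → con 0 :+ x :* (c :* y) := c :* (x :* y)) refl c x (x ^ e))

  eval-coeffs : ∀ {D} ts x → All ((ℕ._< D) ∘ proj₁) ts → eval (applyUpTo (λ r → coeff r ts) D) x ≡ evalTerms ts x
  eval-coeffs {D} []             x []            = eval-zeros D x
  eval-coeffs {D} ((e , c) ∷ ts) x (e<D ∷ ts<D) = begin
    eval (applyUpTo (λ r → monomialCoeff e c r + coeff r ts) D) x
      ≡⟨ eval-+ D (monomialCoeff e c) (λ r → coeff r ts) x ⟩
    eval (applyUpTo (monomialCoeff e c) D) x + eval (applyUpTo (λ r → coeff r ts) D) x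
      ≡⟨ cong₂ _+_ (eval-monomial c x e<D) (eval-coeffs ts x ts<D) ⟩
    c * x ^ e + evalTerms ts x
      ∎

  vanishing-terms⇒coeff≡0 : ∀ ts → All ((ℕ._< N) ∘ proj₁) ts → (∀ x → evalTerms ts x ≡ 0#) →
    ∀ r → coeff r ts ≡ 0#
  vanishing-terms⇒coeff≡0 ts ts<N ts≡0 r with r ℕ.<? N
  ... | yes r<N = All.applyUpTo⁻ (λ r → coeff r ts) N
        (vanishing⇒zero (applyUpTo (λ r → coeff r ts) N) (ℕ.≤-reflexive (List.length-applyUpTo _ N))
          (λ x → trans (eval-coeffs ts x ts<N) (ts≡0 x)))
        r<N
  ... | no  r≮N = coeff-absent ts (All.map (λ e<N e≡r → r≮N (subst (ℕ._< N) e≡r e<N)) ts<N)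

  coeff-isolated : ∀ {e c} xs ys → All (λ t → ¬ proj₁ t ≡ e) xs → All (λ t → ¬ proj₁ t ≡ e) ys →
    coeff e (xs ++ (e , c) ∷ ys) ≡ c
  coeff-isolated {e} {c} [] ys [] ys≢e =
    trans (cong₂ _+_ (monomialCoeff-≡ {e} c refl) (coeff-absent ys ys≢e)) (+-identityʳ c)
  coeff-isolated ((e′ , c′) ∷ xs) ys (e′≢e ∷ xs≢e) ys≢e =
    trans (cong₂ _+_ (monomialCoeff-≢ c′ e′≢e) (coeff-isolated xs ys xs≢e ys≢e)) (+-identityˡ _)

  monomialCoeff-+ : ∀ e a b r → monomialCoeff e (a + b) r ≡ monomialCoeff e a r + monomialCoeff e b r
  monomialCoeff-+ zero    a b zero    = refl
  monomialCoeff-+ zero    a b (suc r) = sym (+-identityˡ 0#)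
  monomialCoeff-+ (suc e) a b zero    = sym (+-identityˡ 0#)
  monomialCoeff-+ (suc e) a b (suc r) = monomialCoeff-+ e a b r

  -- A term whose exponent differs from the other three can only be cancelled by (E₀ , 1#).
  paired-exponents : ∀ {E₀ E₁ E₂ E₃ E₄ c₁ c₂ c₃ c₄} →
    ¬ c₁ ≡ 0# → ¬ c₂ ≡ 0# → ¬ c₃ ≡ 0# → ¬ c₄ ≡ 0# →
    ¬ E₁ ≡ E₂ → ¬ E₁ ≡ E₃ → ¬ E₂ ≡ E₄ → ¬ E₃ ≡ E₄ →
    (∀ e → coeff e ((E₁ , c₁) ∷ (E₂ , c₂) ∷ (E₃ , c₃) ∷ (E₄ , c₄) ∷ (E₀ , 1#) ∷ []) ≡ 0#) →
    E₁ ≡ E₄ × E₂ ≡ E₃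
  paired-exponents {E₀} {E₁} {E₂} {E₃} {E₄} {c₁} {c₂} {c₃} {c₄}
                   c₁≢0 c₂≢0 c₃≢0 c₄≢0 E₁≢E₂ E₁≢E₃ E₂≢E₄ E₃≢E₄ vanish =
    pairs-with E₁ E₄ E₁≡E₀ E₄≡E₀ , pairs-with E₂ E₃ E₂≡E₀ E₃≡E₀
    where
    forced : ∀ {e c} xs ys → ¬ c ≡ 0# → All (λ t → ¬ proj₁ t ≡ e) xs → All (λ t → ¬ proj₁ t ≡ e) ys →
      coeff e (xs ++ (e , c) ∷ ys ++ (E₀ , 1#) ∷ []) ≡ 0# → e ≡ E₀
    forced {e} xs ys c≢0 xs≢e ys≢e vanish-e = decidable-stable (e ℕ.≟ E₀) (λ e≢E₀ →
      c≢0 (trans (sym (coeff-isolated xs (ys ++ (E₀ , 1#) ∷ []) xs≢e (All.++⁺ ys≢e (≢-sym e≢E₀ ∷ [])))) vanish-e))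

    E₁≡E₀ : ¬ E₁ ≡ E₄ → E₁ ≡ E₀
    E₁≡E₀ E₁≢E₄ = forced [] ((E₂ , c₂) ∷ (E₃ , c₃) ∷ (E₄ , c₄) ∷ []) c₁≢0 []
      (≢-sym E₁≢E₂ ∷ ≢-sym E₁≢E₃ ∷ ≢-sym E₁≢E₄ ∷ []) (vanish E₁)

    E₄≡E₀ : ¬ E₁ ≡ E₄ → E₄ ≡ E₀
    E₄≡E₀ E₁≢E₄ = forced ((E₁ , c₁) ∷ (E₂ , c₂) ∷ (E₃ , c₃) ∷ []) [] c₄≢0
      (E₁≢E₄ ∷ E₂≢E₄ ∷ E₃≢E₄ ∷ []) [] (vanish E₄)

    E₂≡E₀ : ¬ E₂ ≡ E₃ → E₂ ≡ E₀
    E₂≡E₀ E₂≢E₃ = forced ((E₁ , c₁) ∷ []) ((E₃ , c₃) ∷ (E₄ , c₄) ∷ []) c₂≢0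
      (E₁≢E₂ ∷ []) (≢-sym E₂≢E₃ ∷ ≢-sym E₂≢E₄ ∷ []) (vanish E₂)

    E₃≡E₀ : ¬ E₂ ≡ E₃ → E₃ ≡ E₀
    E₃≡E₀ E₂≢E₃ = forced ((E₁ , c₁) ∷ (E₂ , c₂) ∷ []) ((E₄ , c₄) ∷ []) c₃≢0
      (E₁≢E₃ ∷ E₂≢E₃ ∷ []) (≢-sym E₃≢E₄ ∷ []) (vanish E₃)

    pairs-with : ∀ a b → (¬ a ≡ b → a ≡ E₀) → (¬ a ≡ b → b ≡ E₀) → a ≡ b
    pairs-with a b a≡E₀ b≡E₀ = decidable-stable (a ℕ.≟ b) (λ a≢b → a≢b (trans (a≡E₀ a≢b) (sym (b≡E₀ a≢b))))

  paired-coefficients : ∀ {E₀ E₁ E₂ c₁ c₂ c₃ c₄} → ¬ E₁ ≡ E₂ →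
    (∀ e → coeff e ((E₁ , c₁) ∷ (E₂ , c₂) ∷ (E₂ , c₃) ∷ (E₁ , c₄) ∷ (E₀ , 1#) ∷ []) ≡ 0#) →
    (c₁ + c₄ ≡ 1# × c₂ + c₃ ≡ 0#) ⊎ (c₁ + c₄ ≡ 0# × c₂ + c₃ ≡ 1#)
  paired-coefficients {E₀} {E₁} {E₂} {c₁} {c₂} {c₃} {c₄} E₁≢E₂ vanish = cases (E₁ ℕ.≟ E₀) (E₂ ℕ.≟ E₀)
    where
    m : ℕ → F → ℕ → F
    m = monomialCoeff

    grouped : ∀ e → coeff e ((E₁ , c₁) ∷ (E₂ , c₂) ∷ (E₂ , c₃) ∷ (E₁ , c₄) ∷ (E₀ , 1#) ∷ []) ≡
      m E₁ (c₁ + c₄) e + m E₂ (c₂ + c₃) e + m E₀ 1# e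
    grouped e = begin
      m E₁ c₁ e + (m E₂ c₂ e + (m E₂ c₃ e + (m E₁ c₄ e + (m E₀ 1# e + 0#))))
        ≡⟨ solve 5 (λ a b c d z → a :+ (b :+ (c :+ (d :+ (z :+ con 0)))) := (a :+ d) :+ (b :+ c) :+ z) refl _ _ _ _ _ ⟩
      (m E₁ c₁ e + m E₁ c₄ e) + (m E₂ c₂ e + m E₂ c₃ e) + m E₀ 1# e
        ≡⟨ cong₂ (λ a b → a + b + m E₀ 1# e) (monomialCoeff-+ E₁ c₁ c₄ e) (monomialCoeff-+ E₂ c₂ c₃ e) ⟨
      m E₁ (c₁ + c₄) e + m E₂ (c₂ + c₃) e + m E₀ 1# e
        ∎

    at : ∀ e {a b z} → m E₁ (c₁ + c₄) e ≡ a → m E₂ (c₂ + c₃) e ≡ b → m E₀ 1# e ≡ z → a + b + z ≡ 0#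
    at e a≡ b≡ z≡ = trans (sym (cong₂ _+_ (cong₂ _+_ a≡ b≡) z≡)) (trans (sym (grouped e)) (vanish e))

    cases : Dec (E₁ ≡ E₀) → Dec (E₂ ≡ E₀) → (c₁ + c₄ ≡ 1# × c₂ + c₃ ≡ 0#) ⊎ (c₁ + c₄ ≡ 0# × c₂ + c₃ ≡ 1#)
    cases (yes E₁≡E₀) _ = inj₁
      ( +≡0⇒≡ (trans (cong (_+ 1#) (sym (+-identityʳ _)))
          (at E₁ (monomialCoeff-≡ {E₁} _ refl) (monomialCoeff-≢ _ (≢-sym E₁≢E₂)) (monomialCoeff-≡ _ (sym E₁≡E₀))))
      , trans (sym (trans (+-identityʳ _) (+-identityˡ _)))
          (at E₂ (monomialCoeff-≢ _ E₁≢E₂) (monomialCoeff-≡ {E₂} _ refl) (monomialCoeff-≢ _ (E₁≢E₂ ∘ trans E₁≡E₀))) )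
    cases (no E₁≢E₀) (yes E₂≡E₀) = inj₂
      ( trans (sym (trans (+-identityʳ _) (+-identityʳ _)))
          (at E₁ (monomialCoeff-≡ {E₁} _ refl) (monomialCoeff-≢ _ (≢-sym E₁≢E₂)) (monomialCoeff-≢ _ (E₁≢E₀ ∘ sym)))
      , +≡0⇒≡ (trans (cong (_+ 1#) (sym (+-identityˡ _)))
          (at E₂ (monomialCoeff-≢ _ E₁≢E₂) (monomialCoeff-≡ {E₂} _ refl) (monomialCoeff-≡ _ (sym E₂≡E₀)))) )
    cases (no E₁≢E₀) (no E₂≢E₀) = contradiction
      (trans (sym (trans (cong (_+ 1#) (+-identityʳ 0#)) (+-identityˡ 1#)))
        (at E₀ (monomialCoeff-≢ _ E₁≢E₀) (monomialCoeff-≢ _ E₂≢E₀) (monomialCoeff-≡ {E₀} _ refl)))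
      (0≢1 ∘ sym)

  -- The involution σ = x ↦ x^(2^m) when n = 2m

  module HalfFrobenius (m : ℕ) (n≡2m : n ≡ 2 ℕ.* m) where

    σ : F → F
    σ = frob m

    n≡m+m : n ≡ m ℕ.+ m
    n≡m+m = trans n≡2m (cong (m ℕ.+_) (ℕ.+-identityʳ m))

    σ-involutive : ∀ x → σ (σ x) ≡ x
    σ-involutive x = trans (sym (frob-∘ m m x)) (trans (cong (λ r → frob r x) (sym n≡m+m)) (frob-period x))

    frob-m+ : ∀ r x → frob (m ℕ.+ r) x ≡ σ (frob r x)
    frob-m+ r x = trans (cong (λ s → frob s x) (ℕ.+-comm m r)) (frob-∘ r m x)

    σ-frob : ∀ r x → σ (frob r x) ≡ frob r (σ x)
    σ-frob r x = trans (sym (frob-m+ r x)) (frob-∘ m r x)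

    σ-binomial : F → F → F → F
    σ-binomial a b y = a * y + b * σ y

    σ-binomial-∘ : ∀ a b c d y →
      σ-binomial a b (σ-binomial c d y) ≡ σ-binomial (a * c + b * σ d) (a * d + b * σ c) y
    σ-binomial-∘ a b c d y = begin
      a * (c * y + d * σ y) + b * σ (c * y + d * σ y)
        ≡⟨ cong (λ z → a * (c * y + d * σ y) + b * z) (frob-linear m c y d (σ y)) ⟩
      a * (c * y + d * σ y) + b * (σ c * σ y + σ d * σ (σ y))
        ≡⟨ cong (λ z → a * (c * y + d * σ y) + b * (σ c * σ y + σ d * z)) (σ-involutive y) ⟩
      a * (c * y + d * σ y) + b * (σ c * σ y + σ d * y)
        ≡⟨ solve 8 (λ a b c d σc σd y σy →
              a :* (c :* y :+ d :* σy) :+ b :* (σc :* σy :+ σd :* y)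
              := (a :* c :+ b :* σd) :* y :+ (a :* d :+ b :* σc) :* σy) refl a b c d (σ c) (σ d) y (σ y) ⟩
      (a * c + b * σ d) * y + (a * d + b * σ c) * σ y
        ∎

    σ-σ-binomial : ∀ a b y → σ (σ-binomial a b y) ≡ σ-binomial (σ b) (σ a) y
    σ-σ-binomial a b y = begin
      σ (a * y + b * σ y)          ≡⟨ frob-linear m a y b (σ y) ⟩
      σ a * σ y + σ b * σ (σ y)    ≡⟨ cong (λ z → σ a * σ y + σ b * z) (σ-involutive y) ⟩
      σ a * σ y + σ b * y          ≡⟨ +-comm _ _ ⟩
      σ b * y + σ a * σ y          ∎

    σ-binomial-1-0 : ∀ y → σ-binomial 1# 0# y ≡ y
    σ-binomial-1-0 y = solve 2 (λ y σy → con 1 :* y :+ con 0 :* σy := y) refl y (σ y)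

    σ-binomial-0-1 : ∀ y → σ-binomial 0# 1# y ≡ σ y
    σ-binomial-0-1 y = solve 2 (λ y σy → con 0 :* y :+ con 1 :* σy := σy) refl y (σ y)

    norm : F → F
    norm y = σ y * y

    ^[2^m+1] : ∀ y → y ^ (2 ℕ.^ m ℕ.+ 1) ≡ norm y
    ^[2^m+1] y = trans (^-+ y (2 ℕ.^ m) 1) (cong (σ y *_) (*-identityʳ y))

    σ-norm : ∀ y → σ (norm y) ≡ norm y
    σ-norm y = trans (frob-* m (σ y) y) (trans (cong (_* σ y) (σ-involutive y)) (*-comm y (σ y)))

    σ-adjugate : ∀ α β a b →
      σ α * (α * a + β * σ b) + β * σ (α * b + β * σ a) ≡ (norm α + norm β) * a
    σ-adjugate α β a b = begin
      σ α * (α * a + β * σ b) + β * σ (α * b + β * σ a)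
        ≡⟨ cong (λ z → σ α * (α * a + β * σ b) + β * z) (frob-linear m α b β (σ a)) ⟩
      σ α * (α * a + β * σ b) + β * (σ α * σ b + σ β * σ (σ a))
        ≡⟨ cong (λ z → σ α * (α * a + β * σ b) + β * (σ α * σ b + σ β * z)) (σ-involutive a) ⟩
      σ α * (α * a + β * σ b) + β * (σ α * σ b + σ β * a)
        ≡⟨ solve 6 (λ σα α β a σb σβ →
              σα :* (α :* a :+ β :* σb) :+ β :* (σα :* σb :+ σβ :* a)
              := (σα :* α :+ σβ :* β) :* a :+ (σα :* β :* σb :+ σα :* β :* σb)) refl (σ α) α β a (σ b) (σ β) ⟩
      (norm α + norm β) * a + (σ α * β * σ b + σ α * β * σ b)
        ≡⟨ cong ((norm α + norm β) * a +_) (x+x≡0 _) ⟩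
      (norm α + norm β) * a + 0#
        ≡⟨ +-identityʳ _ ⟩
      (norm α + norm β) * a
        ∎

  module ExplicitInverse {m i : ℕ} (n≡2m : n ≡ 2 ℕ.* m) (i<m : i ℕ.< m) (α β : F)
    (α^≢β^ : ¬ α ^ (2 ℕ.^ m ℕ.+ 1) ≡ β ^ (2 ℕ.^ m ℕ.+ 1)) where

    open HalfFrobenius m n≡2m

    Φ Ψ : F → F
    Φ = linBinom α i β (m ℕ.+ i)
    Ψ = linBinom (γ-coef m i α β) (m ℕ.∸ i) (δ-coef m i α β) (2 ℕ.* m ℕ.∸ i)

    private
      d : ℕ
      d = m ℕ.∸ i
      D u A B : F
      D = α ^ (2 ℕ.^ m ℕ.+ 1) + β ^ (2 ℕ.^ m ℕ.+ 1)
      u = D ⁻¹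
      A = σ β / D
      B = α / D

      D≡norms : D ≡ norm α + norm β
      D≡norms = cong₂ _+_ (^[2^m+1] α) (^[2^m+1] β)

      D≢0 : ¬ D ≡ 0#
      D≢0 = α^≢β^ ∘ +≡0⇒≡

      D*u≡1 : D * u ≡ 1#
      D*u≡1 = inverseʳ D D≢0

      σu≡u : σ u ≡ u
      σu≡u = trans (frob-⁻¹ m D≢0) (cong _⁻¹ (begin
        σ D                      ≡⟨ cong σ D≡norms ⟩
        σ (norm α + norm β)      ≡⟨ frob-+ m (norm α) (norm β) ⟩
        σ (norm α) + σ (norm β)  ≡⟨ cong₂ _+_ (σ-norm α) (σ-norm β) ⟩
        norm α + norm β          ≡⟨ D≡norms ⟨
        D                        ∎))

      σA≡βu : σ A ≡ β * u
      σA≡βu = trans (frob-* m (σ β) u) (cong₂ _*_ (σ-involutive β) σu≡u)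

      σB≡σαu : σ B ≡ σ α * u
      σB≡σαu = trans (frob-* m α u) (cong (σ α *_) σu≡u)

      norms*u≡1 : ∀ {p q} → p ≡ norm α * u → q ≡ norm β * u → p + q ≡ 1#
      norms*u≡1 p≡ q≡ = trans (cong₂ _+_ p≡ q≡)
        (trans (sym (distribʳ u (norm α) (norm β))) (trans (cong (_* u) (sym D≡norms)) D*u≡1))

      d+i≡m : d ℕ.+ i ≡ m
      d+i≡m = ℕ.m∸n+n≡m (ℕ.<⇒≤ i<m)

      2m∸i≡m+d : 2 ℕ.* m ℕ.∸ i ≡ m ℕ.+ d
      2m∸i≡m+d = trans (cong (ℕ._∸ i) (cong (m ℕ.+_) (ℕ.+-identityʳ m))) (ℕ.+-∸-assoc m (ℕ.<⇒≤ i<m))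

      i+m+d≡n : i ℕ.+ m ℕ.+ d ≡ n
      i+m+d≡n = trans (cong (ℕ._+ d) (ℕ.+-comm i m)) (trans (ℕ.+-assoc m i d)
        (trans (cong (m ℕ.+_) (ℕ.m+[n∸m]≡n (ℕ.<⇒≤ i<m))) (sym n≡m+m)))

    Φ≡σ-binomial : ∀ x → Φ x ≡ σ-binomial α β (frob i x)
    Φ≡σ-binomial x = cong (λ y → α * frob i x + β * y) (frob-m+ i x)

    Ψ≡σ-binomial : ∀ x → Ψ x ≡ frob d (σ-binomial A B x)
    Ψ≡σ-binomial x = begin
      frob d A * frob d x + frob d B * frob (2 ℕ.* m ℕ.∸ i) x
        ≡⟨ cong (λ y → frob d A * frob d x + frob d B * y)
             (trans (cong (λ r → frob r x) 2m∸i≡m+d) (trans (frob-m+ d x) (σ-frob d x))) ⟩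
      frob d A * frob d x + frob d B * frob d (σ x)
        ≡⟨ frob-linear d A x B (σ x) ⟨
      frob d (A * x + B * σ x)
        ∎

    Φ∘Ψ : ∀ x → Φ (Ψ x) ≡ x
    Φ∘Ψ x = begin
      Φ (Ψ x)                                     ≡⟨ Φ≡σ-binomial (Ψ x) ⟩
      σ-binomial α β (frob i (Ψ x))               ≡⟨ cong (σ-binomial α β ∘ frob i) (Ψ≡σ-binomial x) ⟩
      σ-binomial α β (frob i (frob d y))          ≡⟨ cong (σ-binomial α β) (sym (frob-∘ d i y)) ⟩
      σ-binomial α β (frob (d ℕ.+ i) y)           ≡⟨ cong (λ r → σ-binomial α β (frob r y)) d+i≡m ⟩
      σ-binomial α β (σ y)                        ≡⟨ cong (σ-binomial α β) (σ-σ-binomial A B x) ⟩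
      σ-binomial α β (σ-binomial (σ B) (σ A) x)   ≡⟨ σ-binomial-∘ α β (σ B) (σ A) x ⟩
      σ-binomial (α * σ B + β * σ (σ A)) (α * σ A + β * σ (σ B)) x
                                                  ≡⟨ cong₂ (λ p q → σ-binomial p q x) coeff₁ coeff₂ ⟩
      σ-binomial 1# 0# x                          ≡⟨ σ-binomial-1-0 x ⟩
      x                                           ∎
      where
      y : F
      y = σ-binomial A B x
      coeff₁ : α * σ B + β * σ (σ A) ≡ 1#
      coeff₁ = norms*u≡1
        (trans (cong (α *_) σB≡σαu) (solve 3 (λ α σα u → α :* (σα :* u) := σα :* α :* u) refl α (σ α) u))
        (trans (cong (β *_) (σ-involutive A)) (solve 3 (λ β σβ u → β :* (σβ :* u) := σβ :* β :* u) refl β (σ β) u))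
      coeff₂ : α * σ A + β * σ (σ B) ≡ 0#
      coeff₂ = ≡⇒+≡0 (trans (cong (α *_) σA≡βu) (trans (solve 3 (λ α β u → α :* (β :* u) := β :* (α :* u)) refl α β u)
        (cong (β *_) (sym (σ-involutive B)))))

    Ψ∘Φ : ∀ x → Ψ (Φ x) ≡ x
    Ψ∘Φ x = begin
      Ψ (Φ x)                                               ≡⟨ Ψ≡σ-binomial (Φ x) ⟩
      frob d (σ-binomial A B (Φ x))                         ≡⟨ cong (frob d ∘ σ-binomial A B) (Φ≡σ-binomial x) ⟩
      frob d (σ-binomial A B (σ-binomial α β (frob i x)))   ≡⟨ cong (frob d) (σ-binomial-∘ A B α β (frob i x)) ⟩
      frob d (σ-binomial (A * α + B * σ β) (A * β + B * σ α) (frob i x))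
                                                            ≡⟨ cong₂ (λ p q → frob d (σ-binomial p q (frob i x))) coeff₁ coeff₂ ⟩
      frob d (σ-binomial 0# 1# (frob i x))                  ≡⟨ cong (frob d) (σ-binomial-0-1 (frob i x)) ⟩
      frob d (frob m (frob i x))                            ≡⟨ cong (frob d) (frob-∘ i m x) ⟨
      frob d (frob (i ℕ.+ m) x)                             ≡⟨ frob-∘ (i ℕ.+ m) d x ⟨
      frob (i ℕ.+ m ℕ.+ d) x                                ≡⟨ cong (λ r → frob r x) i+m+d≡n ⟩
      frob n x                                              ≡⟨ frob-period x ⟩
      x                                                     ∎
      where
      coeff₁ : A * α + B * σ β ≡ 0#
      coeff₁ = ≡⇒+≡0 (solve 3 (λ σβ u α → σβ :* u :* α := α :* u :* σβ) refl (σ β) u α)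
      coeff₂ : A * β + B * σ α ≡ 1#
      coeff₂ = trans (+-comm (A * β) (B * σ α)) (norms*u≡1
        (solve 3 (λ α u σα → α :* u :* σα := σα :* α :* u) refl α u (σ α))
        (solve 3 (λ σβ u β → σβ :* u :* β := σβ :* β :* u) refl (σ β) u β))

  module BinomialInverse (1≤n : 1 ℕ.≤ n) {i j k ℓ : ℕ} (i<j : i ℕ.< j) (j<n : j ℕ.< n) (k<ℓ : k ℕ.< ℓ) (ℓ<n : ℓ ℕ.< n)
    {α β γ′ δ′ : F} (α≢0 : ¬ α ≡ 0#) (β≢0 : ¬ β ≡ 0#) (γ′≢0 : ¬ γ′ ≡ 0#) (δ′≢0 : ¬ δ′ ≡ 0#)
    (Φ∘Ψ : ∀ x → linBinom α i β j (linBinom γ′ k δ′ ℓ x) ≡ x)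
    (Ψ∘Φ : ∀ x → linBinom γ′ k δ′ ℓ (linBinom α i β j x) ≡ x) where

    private
      Φ Ψ : F → F
      Φ = linBinom α i β j
      Ψ = linBinom γ′ k δ′ ℓ

      i<n : i ℕ.< n
      i<n = ℕ.<-trans i<j j<n
      k<n : k ℕ.< n
      k<n = ℕ.<-trans k<ℓ ℓ<n

      a b c₁ c₂ c₃ c₄ X Y : F
      a = frob i γ′
      b = frob i δ′
      c₁ = α * a
      c₂ = α * b
      c₃ = β * frob j γ′
      c₄ = β * frob j δ′
      X = c₁ + c₄
      Y = c₂ + c₃

      R₁ R₂ R₃ R₄ : ℕ
      R₁ = reduce n (k ℕ.+ i)
      R₂ = reduce n (ℓ ℕ.+ i)
      R₃ = reduce n (k ℕ.+ j)
      R₄ = reduce n (ℓ ℕ.+ j)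

      terms : List (ℕ × F)
      terms = (2 ℕ.^ R₁ , c₁) ∷ (2 ℕ.^ R₂ , c₂) ∷ (2 ℕ.^ R₃ , c₃) ∷ (2 ℕ.^ R₄ , c₄) ∷ (2 ℕ.^ 0 , 1#) ∷ []

      frob-frob : ∀ r s x → frob s (frob r x) ≡ frob (reduce n (r ℕ.+ s)) x
      frob-frob r s x = trans (sym (frob-∘ r s x)) (frob-reduce (r ℕ.+ s) x)

      terms≡Φ∘Ψ+id : ∀ x → evalTerms terms x ≡ Φ (Ψ x) + x
      terms≡Φ∘Ψ+id x = sym (begin
        α * frob i (γ′ * frob k x + δ′ * frob ℓ x) + β * frob j (γ′ * frob k x + δ′ * frob ℓ x) + x
          ≡⟨ cong₂ (λ p q → α * p + β * q + x) (frob-linear i γ′ (frob k x) δ′ (frob ℓ x))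
                                              (frob-linear j γ′ (frob k x) δ′ (frob ℓ x)) ⟩
        α * (a * frob i (frob k x) + b * frob i (frob ℓ x)) + β * (frob j γ′ * frob j (frob k x) + frob j δ′ * frob j (frob ℓ x)) + x
          ≡⟨ cong₂ (λ p q → α * p + β * q + x)
               (cong₂ (λ p q → a * p + b * q) (frob-frob k i x) (frob-frob ℓ i x))
               (cong₂ (λ p q → frob j γ′ * p + frob j δ′ * q) (frob-frob k j x) (frob-frob ℓ j x)) ⟩
        α * (a * frob R₁ x + b * frob R₂ x) + β * (frob j γ′ * frob R₃ x + frob j δ′ * frob R₄ x) + x
          ≡⟨ solve 11 (λ α β a b a′ b′ X₁ X₂ X₃ X₄ x →
                α :* (a :* X₁ :+ b :* X₂) :+ β :* (a′ :* X₃ :+ b′ :* X₄) :+ x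
                := α :* a :* X₁ :+ (α :* b :* X₂ :+ (β :* a′ :* X₃ :+ (β :* b′ :* X₄ :+ (con 1 :* (x :* con 1) :+ con 0)))))
               refl α β a b (frob j γ′) (frob j δ′) (frob R₁ x) (frob R₂ x) (frob R₃ x) (frob R₄ x) x ⟩
        evalTerms terms x
          ∎)

      2^-<-N : ∀ {r} → r ℕ.< n → 2 ℕ.^ r ℕ.< N
      2^-<-N = ℕ.^-monoʳ-< 2 (ℕ.s≤s (ℕ.s≤s ℕ.z≤n))

      reduce-<-n : ∀ {r s} → r ℕ.< n → s ℕ.< n → reduce n (r ℕ.+ s) ℕ.< n
      reduce-<-n r<n s<n = reduce-< (ℕ.+-mono-< r<n s<n)

      vanish : ∀ e → coeff e terms ≡ 0#
      vanish = vanishing-terms⇒coeff≡0 terms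
        ( 2^-<-N (reduce-<-n k<n i<n) ∷ 2^-<-N (reduce-<-n ℓ<n i<n) ∷ 2^-<-N (reduce-<-n k<n j<n)
        ∷ 2^-<-N (reduce-<-n ℓ<n j<n) ∷ 2^-<-N 1≤n ∷ [])
        (λ x → trans (terms≡Φ∘Ψ+id x) (≡⇒+≡0 (Φ∘Ψ x)))

      E₁≢E₂ : ¬ 2 ℕ.^ R₁ ≡ 2 ℕ.^ R₂
      E₁≢E₂ = ℕ.<⇒≢ k<ℓ ∘ reduce-cancelʳ i k<n ℓ<n ∘ 2^-injective
      E₁≢E₃ : ¬ 2 ℕ.^ R₁ ≡ 2 ℕ.^ R₃
      E₁≢E₃ = ℕ.<⇒≢ i<j ∘ reduce-cancelˡ k i<n j<n ∘ 2^-injective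
      E₂≢E₄ : ¬ 2 ℕ.^ R₂ ≡ 2 ℕ.^ R₄
      E₂≢E₄ = ℕ.<⇒≢ i<j ∘ reduce-cancelˡ ℓ i<n j<n ∘ 2^-injective
      E₃≢E₄ : ¬ 2 ℕ.^ R₃ ≡ 2 ℕ.^ R₄
      E₃≢E₄ = ℕ.<⇒≢ k<ℓ ∘ reduce-cancelʳ j k<n ℓ<n ∘ 2^-injective

      nonzero-coefficients : ¬ c₁ ≡ 0# × ¬ c₂ ≡ 0# × ¬ c₃ ≡ 0# × ¬ c₄ ≡ 0#
      nonzero-coefficients =
          *-nonzero α≢0 (frob-nonzero i γ′≢0) , *-nonzero α≢0 (frob-nonzero i δ′≢0)
        , *-nonzero β≢0 (frob-nonzero j γ′≢0) , *-nonzero β≢0 (frob-nonzero j δ′≢0)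

      exponents-pair : 2 ℕ.^ R₁ ≡ 2 ℕ.^ R₄ × 2 ℕ.^ R₂ ≡ 2 ℕ.^ R₃
      exponents-pair = let (c₁≢0 , c₂≢0 , c₃≢0 , c₄≢0) = nonzero-coefficients in
        paired-exponents {E₀ = 1} c₁≢0 c₂≢0 c₃≢0 c₄≢0 E₁≢E₂ E₁≢E₃ E₂≢E₄ E₃≢E₄ vanish

      coefficients-pair : (X ≡ 1# × Y ≡ 0#) ⊎ (X ≡ 0# × Y ≡ 1#)
      coefficients-pair = paired-coefficients {E₀ = 1} E₁≢E₂
        (subst₂ (λ E₃ E₄ → ∀ e → coeff e ((2 ℕ.^ R₁ , c₁) ∷ (2 ℕ.^ R₂ , c₂) ∷ (E₃ , c₃) ∷ (E₄ , c₄) ∷ (1 , 1#) ∷ []) ≡ 0#)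
          (sym (proj₂ exponents-pair)) (sym (proj₁ exponents-pair)) vanish)

    half-shift-exponents : ∃[ m ] (1 ℕ.≤ m × n ≡ 2 ℕ.* m × j ≡ m ℕ.+ i)
    half-shift-exponents = half-shift i<j j<n k<ℓ ℓ<n
      (2^-injective (proj₁ exponents-pair)) (2^-injective (proj₂ exponents-pair))

    module _ {m : ℕ} (n≡2m : n ≡ 2 ℕ.* m) (j≡m+i : j ≡ m ℕ.+ i) where

      open HalfFrobenius m n≡2m

      private
        i<m : i ℕ.< m
        i<m = ℕ.+-cancelˡ-< m i m (subst₂ ℕ._<_ j≡m+i n≡m+m j<n)

        frob-j : ∀ y → frob j y ≡ σ (frob i y)
        frob-j y = trans (cong (λ r → frob r y) j≡m+i) (frob-m+ i y)

        adjugate : σ α * X + β * σ Y ≡ (norm α + norm β) * a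
        adjugate = trans (cong₂ (λ p q → σ α * (c₁ + β * p) + β * σ (c₂ + β * q)) (frob-j δ′) (frob-j γ′))
          (σ-adjugate α β a b)

        α^≢β^ : ¬ α ^ (2 ℕ.^ m ℕ.+ 1) ≡ β ^ (2 ℕ.^ m ℕ.+ 1)
        α^≢β^ α^≡β^ = refute coefficients-pair
          where
          adjugate≡0 : σ α * X + β * σ Y ≡ 0#
          adjugate≡0 = trans adjugate (trans (cong (_* a) norms≡0) (zeroˡ a))
            where
            norms≡0 : norm α + norm β ≡ 0#
            norms≡0 = trans (sym (cong₂ _+_ (^[2^m+1] α) (^[2^m+1] β))) (≡⇒+≡0 α^≡β^)

          refute : (X ≡ 1# × Y ≡ 0#) ⊎ (X ≡ 0# × Y ≡ 1#) → ⊥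
          refute (inj₁ (X≡1 , Y≡0)) = frob-nonzero m α≢0 (begin
            σ α                                ≡⟨ solve 2 (λ σα β → σα := σα :* con 1 :+ β :* con 0) refl (σ α) β ⟩
            σ α * 1# + β * 0#                  ≡⟨ cong (λ z → σ α * 1# + β * z) (frob-0# m) ⟨
            σ α * 1# + β * σ 0#                ≡⟨ cong₂ (λ p q → σ α * p + β * σ q) X≡1 Y≡0 ⟨
            σ α * X + β * σ Y  ≡⟨ adjugate≡0 ⟩
            0#                                 ∎)
          refute (inj₂ (X≡0 , Y≡1)) = β≢0 (begin
            β                                  ≡⟨ solve 2 (λ σα β → β := σα :* con 0 :+ β :* con 1) refl (σ α) β ⟩
            σ α * 0# + β * 1#                  ≡⟨ cong (λ z → σ α * 0# + β * z) (frob-1# m) ⟨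
            σ α * 0# + β * σ 1#                ≡⟨ cong₂ (λ p q → σ α * p + β * σ q) X≡0 Y≡1 ⟨
            σ α * X + β * σ Y  ≡⟨ adjugate≡0 ⟩
            0#                                 ∎)

        module Explicit = ExplicitInverse n≡2m i<m α β α^≢β^

      Ψ≡explicit : ∀ x → linBinom γ′ k δ′ ℓ x ≡ Explicit.Ψ x
      Ψ≡explicit x = begin
        Ψ x                   ≡⟨ cong Ψ Φ∘Ψₑ ⟨
        Ψ (Φ (Explicit.Ψ x))  ≡⟨ Ψ∘Φ (Explicit.Ψ x) ⟩
        Explicit.Ψ x          ∎
        where
        Φ∘Ψₑ : Φ (Explicit.Ψ x) ≡ x
        Φ∘Ψₑ = subst (λ j → linBinom α i β j (Explicit.Ψ x) ≡ x) (sym j≡m+i) (Explicit.Φ∘Ψ x)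

    inverse-is-explicit : ∃[ m ] (1 ℕ.≤ m × n ≡ 2 ℕ.* m × j ≡ m ℕ.+ i × (∀ x → linBinom γ′ k δ′ ℓ x ≡
      linBinom (γ-coef m i α β) (m ℕ.∸ i) (δ-coef m i α β) (2 ℕ.* m ℕ.∸ i) x))
    inverse-is-explicit =
      let (m , 1≤m , n≡2m , j≡m+i) = half-shift-exponents in m , 1≤m , n≡2m , j≡m+i , Ψ≡explicit n≡2m j≡m+i

open Defs using (F; 0#; linBinom; IsPermutation; IsInverseOf; γ-coef; δ-coef; pow)
open import Data.Nat using (_<_; _≤_; _∸_; _*_; _+_; _^_)

mainTheorem2 : (n : ℕ) → 1 ≤ n → (K : FiniteField2^ n) →
    (∀ (i j : ℕ) → i < j → j < n → (α β : F K) →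
      ¬ (α ≡ 0# K) → ¬ (β ≡ 0# K) →
      IsPermutation K (linBinom K α i β j) →
      (k ℓ : ℕ) → k < ℓ → ℓ < n → (γ′ δ′ : F K) →
      ¬ (γ′ ≡ 0# K) → ¬ (δ′ ≡ 0# K) →
      IsInverseOf K (linBinom K γ′ k δ′ ℓ) (linBinom K α i β j) →
      ∃[ m ] (1 ≤ m × n ≡ 2 * m × j ≡ m + i ×
        (∀ x → linBinom K γ′ k δ′ ℓ x ≡
          linBinom K (γ-coef K m i α β) (m ∸ i) (δ-coef K m i α β) (2 * m ∸ i) x)))
    ×
    (∀ (m i : ℕ) → n ≡ 2 * m → i < m → (α β : F K) →
      ¬ (pow K α (2 ^ m + 1) ≡ pow K β (2 ^ m + 1)) →
      IsPermutation K (linBinom K α i β (m + i)) ×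
      IsInverseOf K
        (linBinom K (γ-coef K m i α β) (m ∸ i) (δ-coef K m i α β) (2 * m ∸ i))
        (linBinom K α i β (m + i)))
mainTheorem2 n 1≤n K =
    -- the ignored hypothesis (Φ is a permutation) follows from the two-sided inverse anyway
    (λ i j i<j j<n α β α≢0 β≢0 _ k ℓ k<ℓ ℓ<n γ′ δ′ γ′≢0 δ′≢0 (Φ∘Ψ , Ψ∘Φ) →
      BinomialInverse.inverse-is-explicit K 1≤n i<j j<n k<ℓ ℓ<n α≢0 β≢0 γ′≢0 δ′≢0 Φ∘Ψ Ψ∘Φ)
  , (λ m i n≡2m i<m α β α^≢β^ → let open ExplicitInverse K n≡2m i<m α β α^≢β^ in
      Bijection.bijective (↔⇒⤖ (mk↔ₛ′ Φ Ψ Φ∘Ψ Ψ∘Φ)) , Φ∘Ψ , Ψ∘Φ)
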